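{- Let $L\subseteq\{0,1\}^k$ be a finite set of vectors, with rows indexed by $R=\{1,\dots,k\}$. (1) Consider any CO multiordering of $L$. Let $S\subseteq R$, let $x,y\in L$ be $S$-connected, and let $z\in L$ be $0$ on $S$. Then no column equal to $z$ lies strictly between a column equal to $x$ and a column equal to $y$. (2) If $z\in L$ is bound between $x\in L$ and $y\in L$, then in any CO ordering of $L$ the column $z$ lies strictly between the columns $x$ and $y$.
   Context: A $0$-$1$ matrix is CO if in every row the $1$'s (if any) form a single contiguous block. Let $L$ be a set of $n$ distinct vectors in $\{0,1\}^k$. - An ordering of $L$ is a $k\times n$ matrix whose columns are a permutation of $L$. - A multiordering of $L$ is a $k\times n'$ matrix, $n'\ge n$, whose columns all lie in $L$, with every element of $L$ appearing at least once. Let $S\subseteq R$. - A vector $x$ is $0$ on $S$ (resp. $1$ on $S$) if $x_r=0$ (resp. $x_r=1$) for all $r\in S$. - $G_S$ is the graph with vertex set $L$, in which $x,y$ are adjacent if there is $r\in S$ with $x_r=y_r=1$. - $x,y\in L$ are $S$-connected if they lie in the same connected component of $G_S$. Suppose $x,y\in L$ and rows $r_1,r_2$ are such that $x_{r_1}=1,y_{r_1}=0,x_{r_2}=0,y_{r_2}=1$. If $z\in L$ is $1$ on $\{r_1,r_2\}$, then $z$ is said to be bound between $x$ and $y$. -}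

module Defs where

open import Data.Bool using (Bool; true; false)
open import Data.Nat using (ℕ)
open import Data.Fin using (Fin; _<_)
open import Data.Fin.Subset using (Subset) renaming (_∈_ to _∈ₛ_)
open import Data.Vec using (Vec; lookup)
open import Data.List using (List; length)
import Data.List as List
open import Data.List.Membership.Propositional using (_∈_)
open import Data.List.Relation.Unary.All using (All)
open import Data.List.Relation.Binary.Permutation.Propositional using (_↭_)
open import Data.Product using (_×_; ∃; ∃-syntax; Σ-syntax)
open import Data.Sum using (_⊎_)
open import Relation.Binary.PropositionalEquality using (_≡_)
open import Relation.Binary.Construct.Closure.ReflexiveTransitive using (Star)

-- A vector in {0,1}^k; rows are indexed by Fin k; 1 = true, 0 = false.
BVec : ℕ → Set
BVec k = Vec Bool k

-- A k × m matrix is given by its list of columns (left to right).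
Matrix : ℕ → Set
Matrix k = List (BVec k)

col : ∀ {k} (M : Matrix k) → Fin (length M) → BVec k
col M i = List.lookup M i

CO : ∀ {k} → Matrix k → Set
CO {k} M = ∀ (r : Fin k) (i j l : Fin (length M)) → i < j → j < l →
  lookup (col M i) r ≡ true → lookup (col M l) r ≡ true →
  lookup (col M j) r ≡ true

IsOrdering : ∀ {k} → List (BVec k) → Matrix k → Set
IsOrdering L M = M ↭ L

IsMultiordering : ∀ {k} → List (BVec k) → Matrix k → Set
IsMultiordering L M = All (_∈ L) M × All (_∈ M) L

ZeroOn : ∀ {k} → Subset k → BVec k → Set
ZeroOn {k} S x = ∀ (r : Fin k) → r ∈ₛ S → lookup x r ≡ false

Adj : ∀ {k} → List (BVec k) → Subset k → BVec k → BVec k → Set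
Adj {k} L S x y = x ∈ L × y ∈ L ×
  ∃[ r ] (r ∈ₛ S × lookup x r ≡ true × lookup y r ≡ true)

SConnected : ∀ {k} → List (BVec k) → Subset k → BVec k → BVec k → Set
SConnected L S x y = x ∈ L × y ∈ L × Star (Adj L S) x y

BoundBetween : ∀ {k} → BVec k → BVec k → BVec k → Set
BoundBetween {k} z x y = ∃[ r₁ ] ∃[ r₂ ]
  (lookup x r₁ ≡ true × lookup y r₁ ≡ false ×
   lookup x r₂ ≡ false × lookup y r₂ ≡ true ×
   lookup z r₁ ≡ true × lookup z r₂ ≡ true)

StrictlyBetween : ∀ {k} → Matrix k → BVec k → BVec k → BVec k → Set
StrictlyBetween M z x y = ∃[ i ] ∃[ j ] ∃[ l ]
  (i < j × j < l × col M j ≡ z ×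
   ((col M i ≡ x × col M l ≡ y) ⊎ (col M i ≡ y × col M l ≡ x)))

module Submission where

-- Both parts rest on one consequence of the CO property: if columns a and c
-- both carry a 1 in row r, then every column strictly between them also
-- carries a 1 in row r ('noGapInRow').
--
-- (1) Let column j equal z, which is 0 on S.  If a column left of j has a 1
--     in some row r ∈ S, then every column with a 1 in row r is left of j
--     (otherwise j would be a 0 inside the block of row r).  Hence an edge of
--     G_S carries the property "every occurrence lies left of j" from one
--     vertex to the next, and so does every path.  Since x ≠ y, a path from x
--     to y starts with an edge, which makes x active on S; so if some copy of
--     x is left of j, every copy of y is left of j too, contradicting a copy
--     of y to the right of j.  The mirrored configuration uses the reversed
--     path.
-- (2) Let a, b, c be the positions of x, y, z.  Row r₁ (x = z = 1, y = 0)
--     forbids y between x and z, row r₂ forbids x between y and z, and these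
--     rows also make a, b, c pairwise distinct.  Among three distinct
--     positions one lies in the middle ('middleOfThree'), so it must be z.

open import Defs
open import Data.Nat using (ℕ)
open import Data.Fin.Subset using (Subset)
open import Data.List using (List)
open import Data.List.Membership.Propositional using (_∈_)
open import Data.List.Relation.Unary.Unique.Propositional using (Unique)
open import Data.Product using (_×_)
open import Relation.Nullary using (¬_)
open import Relation.Binary.PropositionalEquality using (_≡_)

open import Data.Bool using (Bool; true; false)
open import Data.Fin using (Fin; _<_)
open import Data.Fin.Subset using () renaming (_∈_ to _∈ₛ_)
open import Data.Fin.Properties using (<-cmp; <-asym)
open import Relation.Binary.Definitions using (tri<; tri≈; tri>)
open import Data.Vec using (lookup)
open import Data.List using (length)
open import Data.Product using (_,_; ∃-syntax)
open import Data.Sum using (_⊎_; inj₁; inj₂)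
open import Data.Empty using (⊥; ⊥-elim)
open import Relation.Binary.PropositionalEquality using (refl; sym; trans; ≢-sym)
open import Relation.Binary.Construct.Closure.ReflexiveTransitive using (Star; ε; _◅_; reverse)
open import Data.List.Relation.Unary.Any using (index)
open import Data.List.Relation.Unary.Any.Properties using (lookup-index)
open import Data.List.Relation.Unary.All as All using (All)
open import Data.List.Relation.Binary.Permutation.Propositional using (↭-sym)
open import Data.List.Relation.Binary.Permutation.Propositional.Properties using (∈-resp-↭)

notBoth : ∀ {b : Bool} → b ≡ true → b ≡ false → ⊥
notBoth p q with trans (sym p) q
... | ()

Between : ∀ {n} → Fin n → Fin n → Fin n → Set
Between i j l = (i < j × j < l) ⊎ (l < j × j < i)

middleOfThree : ∀ {n} {a b c : Fin n} → ¬ a ≡ b → ¬ a ≡ c → ¬ b ≡ c →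
  ¬ Between a b c → ¬ Between b a c → Between a c b
middleOfThree {a = a} {b} {c} a≢b a≢c b≢c bMid aMid with <-cmp a c | <-cmp c b | <-cmp a b
... | tri≈ _ a≡c _ | _              | _              = ⊥-elim (a≢c a≡c)
... | _            | tri≈ _ c≡b _   | _              = ⊥-elim (b≢c (sym c≡b))
... | _            | _              | tri≈ _ a≡b _   = ⊥-elim (a≢b a≡b)
... | tri< a<c _ _ | tri< c<b _ _   | _              = inj₁ (a<c , c<b)
... | tri< a<c _ _ | tri> _ _ b<c   | tri< a<b _ _   = ⊥-elim (bMid (inj₁ (a<b , b<c)))
... | tri< a<c _ _ | tri> _ _ b<c   | tri> _ _ b<a   = ⊥-elim (aMid (inj₁ (b<a , a<c)))
... | tri> _ _ c<a | tri> _ _ b<c   | _              = inj₂ (b<c , c<a)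
... | tri> _ _ c<a | tri< c<b _ _   | tri< a<b _ _   = ⊥-elim (aMid (inj₂ (c<a , a<b)))
... | tri> _ _ c<a | tri< c<b _ _   | tri> _ _ b<a   = ⊥-elim (bMid (inj₂ (c<b , b<a)))

adjSym : ∀ {k} {L : List (BVec k)} {S : Subset k} {x y : BVec k} →
  Adj L S x y → Adj L S y x
adjSym (xL , yL , r , rS , xr , yr) = yL , xL , r , rS , yr , xr

ActiveOn : ∀ {k} → Subset k → BVec k → Set
ActiveOn {k} S v = ∃[ r ] (r ∈ₛ S × lookup v r ≡ true)

pathStartActive : ∀ {k} {L : List (BVec k)} {S : Subset k} {x y : BVec k} →
  ¬ x ≡ y → Star (Adj L S) x y → ActiveOn S x
pathStartActive x≢y ε = ⊥-elim (x≢y refl)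
pathStartActive _ ((_ , _ , r , rS , xr , _) ◅ _) = r , rS , xr

module Columns {k : ℕ} (M : Matrix k) where

  Pos : Set
  Pos = Fin (length M)

  entry : ∀ {p : Pos} {v : BVec k} {r : Fin k} {b : Bool} →
    col M p ≡ v → lookup v r ≡ b → lookup (col M p) r ≡ b
  entry refl e = e

  occurrence : ∀ {v : BVec k} → v ∈ M → ∃[ p ] col M p ≡ v
  occurrence v∈M = index v∈M , sym (lookup-index v∈M)

  orderingOccurrence : ∀ {L : List (BVec k)} {v : BVec k} → IsOrdering L M → v ∈ L →
    ∃[ p ] col M p ≡ v
  orderingOccurrence perm v∈L = occurrence (∈-resp-↭ (↭-sym perm) v∈L)

  differentPositions : ∀ {p q : Pos} {r : Fin k} →
    lookup (col M p) r ≡ true → lookup (col M q) r ≡ false → ¬ p ≡ q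
  differentPositions pr qr refl = notBoth pr qr

  noGapInRow : CO M → ∀ {a b c : Pos} (r : Fin k) →
    lookup (col M a) r ≡ true → lookup (col M b) r ≡ false →
    lookup (col M c) r ≡ true → ¬ Between a b c
  noGapInRow co {a} {b} {c} r ar br cr (inj₁ (a<b , b<c)) = notBoth (co r a b c a<b b<c ar cr) br
  noGapInRow co {a} {b} {c} r ar br cr (inj₂ (c<b , b<a)) = notBoth (co r c b a c<b b<a cr ar) br

  boundInMiddle : CO M → ∀ {x y z : BVec k} → BoundBetween z x y →
    ∀ {a b c : Pos} → col M a ≡ x → col M b ≡ y → col M c ≡ z → Between a c b
  boundInMiddle co (r₁ , r₂ , x1 , y1 , x2 , y2 , z1 , z2) ca cb cc =
    middleOfThree
      (differentPositions (entry ca x1) (entry cb y1))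
      (≢-sym (differentPositions (entry cc z2) (entry ca x2)))
      (≢-sym (differentPositions (entry cc z1) (entry cb y1)))
      (noGapInRow co r₁ (entry ca x1) (entry cb y1) (entry cc z1))
      (noGapInRow co r₂ (entry cb y2) (entry ca x2) (entry cc z2))

  module LeftOfZeroColumn (co : CO M) {S : Subset k} {z : BVec k} (zS : ZeroOn S z)
                          {j : Pos} (cj : col M j ≡ z) where

    AllLeft : BVec k → Set
    AllLeft v = ∀ (q : Pos) → col M q ≡ v → q < j

    rowBlockLeft : ∀ {r : Fin k} {p q : Pos} → r ∈ₛ S → p < j →
      lookup (col M p) r ≡ true → lookup (col M q) r ≡ true → q < j
    rowBlockLeft {r} {p} {q} rS p<j pr qr with <-cmp q j
    ... | tri< q<j _ _ = q<j
    ... | tri≈ _ refl _ = ⊥-elim (notBoth qr (entry cj (zS r rS)))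
    ... | tri> _ _ j<q = ⊥-elim (notBoth (co r p j q p<j j<q pr qr) (entry cj (zS r rS)))

    activeLeft : ∀ {u : BVec k} {p : Pos} → ActiveOn S u → p < j → col M p ≡ u → AllLeft u
    activeLeft (r , rS , ur) p<j cp q cq = rowBlockLeft rS p<j (entry cp ur) (entry cq ur)

    -- Edges of G_S preserve AllLeft: the shared row of S carries it across.
    edgeLeft : ∀ {L : List (BVec k)} {u v : BVec k} → All (_∈ M) L →
      Adj L S u v → AllLeft u → AllLeft v
    edgeLeft LinM (uL , _ , r , rS , ur , vr) uLeft q cq with occurrence (All.lookup LinM uL)
    ... | p , cp = rowBlockLeft rS (uLeft p cp) (entry cp ur) (entry cq vr)

    pathLeft : ∀ {L : List (BVec k)} {u w : BVec k} → All (_∈ M) L →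
      Star (Adj L S) u w → AllLeft u → AllLeft w
    pathLeft LinM ε uLeft = uLeft
    pathLeft LinM (e ◅ path) uLeft = pathLeft LinM path (edgeLeft LinM e uLeft)

    notAcross : ∀ {L : List (BVec k)} {x y : BVec k} → All (_∈ M) L →
      ¬ x ≡ y → Star (Adj L S) x y → ∀ {i l : Pos} →
      i < j → col M i ≡ x → j < l → col M l ≡ y → ⊥
    notAcross LinM x≢y path i<j ci j<l cl =
      <-asym j<l (pathLeft LinM path (activeLeft (pathStartActive x≢y path) i<j ci) _ cl)

part1 : ∀ {k : ℕ} {L : List (BVec k)} (M : Matrix k) → IsMultiordering L M → CO M →
  ∀ (S : Subset k) (x y z : BVec k) → ¬ x ≡ y →
  SConnected L S x y → z ∈ L → ZeroOn S z → ¬ StrictlyBetween M z x y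
part1 M (_ , LinM) co S x y z x≢y (_ , _ , path) _ zS
      (i , j , l , i<j , j<l , cj , inj₁ (ci , cl)) =
  notAcross LinM x≢y path i<j ci j<l cl
  where open Columns.LeftOfZeroColumn M co zS cj
part1 M (_ , LinM) co S x y z x≢y (_ , _ , path) _ zS
      (i , j , l , i<j , j<l , cj , inj₂ (ci , cl)) =
  notAcross LinM (≢-sym x≢y) (reverse adjSym path) i<j ci j<l cl
  where open Columns.LeftOfZeroColumn M co zS cj

part2 : ∀ {k : ℕ} {L : List (BVec k)} (x y z : BVec k) → x ∈ L → y ∈ L → z ∈ L →
  BoundBetween z x y → ∀ (M : Matrix k) → IsOrdering L M → CO M →
  StrictlyBetween M z x y
part2 x y z xL yL zL bound M perm co
  with orderingOccurrence perm xL | orderingOccurrence perm yL | orderingOccurrence perm zL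
  where open Columns M
... | a , ca | b , cb | c , cc with Columns.boundInMiddle M co bound ca cb cc
... | inj₁ (a<c , c<b) = a , c , b , a<c , c<b , cc , inj₁ (ca , cb)
... | inj₂ (b<c , c<a) = b , c , a , b<c , c<a , cc , inj₂ (cb , ca)

lemma3p11 : ∀ (k : ℕ) (L : List (BVec k)) → Unique L →
    (∀ (M : Matrix k) → IsMultiordering L M → CO M →
    ∀ (S : Subset k) (x y z : BVec k) → ¬ (x ≡ y) →
    SConnected L S x y → z ∈ L → ZeroOn S z →
    ¬ StrictlyBetween M z x y)
    ×
    (∀ (x y z : BVec k) → x ∈ L → y ∈ L → z ∈ L → BoundBetween z x y →
    ∀ (M : Matrix k) → IsOrdering L M → CO M →
    StrictlyBetween M z x y)
lemma3p11 k L _ = part1 , part2
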